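{- Let $k>2$ be even, $m$ a positive integer, and $n=km/2$. For $t\in[m]$ let $V_t=\{\tfrac{k}{2}(t-1)+1,\dots,\tfrac{k}{2}t\}\subseteq[n]$. Let $K_{n,n}$ be the complete bipartite graph with parts $U_1=[n]$ and $U_2=\bigcup_{t=1}^m E_t$, where $E_t=\{e_t^1,\dots,e_t^{k/2}\}$ are pairwise disjoint sets of new symbols, and let $\hat K_{n,n}$ be obtained by deleting all edges between $V_t$ and $E_t$ for every $t\in[m]$. Let $\hat M$ be a perfect matching of $\hat K_{n,n}$, let $W_t\subseteq[n]$ be the set of vertices matched to $E_t$ in $\hat M$, and assume that whenever $W_t=V_s$ for some $s\neq t$, one has $W_s\neq V_t$. Let $G$ be the hypergraph with vertex set $[n]$ and edges $e_t=V_t\cup W_t$, $t\in[m]$. Then $G$ is a $2$-regular $k$-uniform hypergraph on $n$ vertices (with no multiple edges, i.e. $e_1,\dots,e_m$ are pairwise distinct).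
   Context: A hypergraph is $k$-uniform if every edge has exactly $k$ vertices and $2$-regular if every vertex lies in exactly two edges; hypergraphs are required to have no multiple edges. -}

module Defs where

open import Data.Nat using (ℕ; _*_; _≤_; _<_; _≤?_; _<?_; suc)
open import Data.Fin using (Fin; toℕ)
open import Data.Fin.Subset using (Subset; _∪_; ⁅_⁆; ⋃; _∈_)
open import Data.Fin.Subset.Properties using (_∈?_)
open import Data.Product using (_×_; _,_)
open import Data.List using (map)
open import Data.List using () renaming (allFin to allFinL)
open import Data.Vec using (tabulate)
open import Relation.Nullary using (¬_; does)
open import Relation.Nullary.Decidable using (_×-dec_)
open import Function.Bundles using (_⤖_; Bijection)

-- Conventions (0-based): with h = k/2, the vertex set [n] is Fin (h * m),
-- vertex i ∈ Fin n stands for i+1; the index t ∈ [m] is Fin m (t stands for t+1).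
-- The symbol e_t^j (t ∈ [m], j ∈ [h]) is the pair (t , j) : Fin m × Fin h,
-- so U₂ = ⋃_t E_t is Fin m × Fin h (the E_t are pairwise disjoint).

V : (h m : ℕ) → Fin m → Subset (h * m)
V h m t = tabulate λ i → does ((h * toℕ t ≤? toℕ i) ×-dec (toℕ i <? h * suc (toℕ t)))

-- A perfect matching of K̂_{n,n}: a bijection between U₂ and U₁ = [n]
-- (each e_t^j matched to a unique vertex), using only edges of K̂_{n,n},
-- i.e. e_t^j is never matched into V_t.
record PerfectMatchingK̂ (h m : ℕ) : Set where
  field
    match   : (Fin m × Fin h) ⤖ Fin (h * m)
    avoids  : ∀ t j → ¬ (Bijection.to match (t , j) ∈ V h m t)

W : (h m : ℕ) → PerfectMatchingK̂ h m → Fin m → Subset (h * m)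
W h m M t = ⋃ (map (λ j → ⁅ Bijection.to (PerfectMatchingK̂.match M) (t , j) ⁆) (allFinL h))

edge : (h m : ℕ) → PerfectMatchingK̂ h m → Fin m → Subset (h * m)
edge h m M t = V h m t ∪ W h m M t

edgesAt : (h m : ℕ) → PerfectMatchingK̂ h m → Fin (h * m) → Subset m
edgesAt h m M v = tabulate λ t → does (v ∈? edge h m M t)

-- W_t is the image of E_t under the matching and V_t the image of E_t under
-- the row-major numbering (t , j) ↦ h t + j, so both families partition [n]
-- into m blocks of size h, and V_t ∩ W_t = ∅ because the matching avoids V_t.
-- Hence |e_t| = 2h; a vertex lies in exactly one V_a and one W_b, with a ≠ b,
-- so exactly in e_a and e_b; and e_s = e_t for s ≠ t forces W_t = V_s and
-- W_s = V_t by disjointness of the blocks, which the hypothesis excludes.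
module Submission where

open import Defs
open import Data.Bool using (true)
open import Data.Nat using (ℕ; suc; _+_; _*_; _<_; _≤_; _≤?_; _<?_)
open import Data.Nat.Properties
  using (+-suc; +-comm; +-identityʳ; *-comm; *-suc; m≤m+n; +-monoʳ-<; *-monoʳ-≤; <-≤-trans; ≤-trans; <-irrefl; ≮⇒≥; ≤-antisym)
open import Data.Fin using (Fin; toℕ; combine; cast; _≟_)
open import Data.Fin.Properties
  using (toℕ-injective; toℕ-cast; toℕ-combine; toℕ<n; combine-injective; combine-surjective; cast-involutive)
open import Data.Fin.Subset using (Subset; ∣_∣; _∪_; ⁅_⁆; ⋃; _∈_; _∉_; _⊆_; inside; outside)
open import Data.Fin.Subset.Properties
  using (_∈?_; ∣⊥∣≡0; ∉⊥; x∈⁅x⁆; x∈⁅y⁆⇒x≡y; x∈⁅y⁆⇔x≡y; x∈p∪q⁻; x∈p∪q⁺; p⊆p∪q; q⊆p∪q; ⊆-antisym; ∣⁅x⁆∣≡1)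
open import Data.Product using (_×_; ∃; ∃₂; _,_; proj₁; proj₂)
open import Data.Sum using (inj₁; inj₂)
import Data.Sum as Sum
open import Data.List using (List; []; _∷_; map; length; allFin)
open import Data.List.Properties using (length-tabulate)
open import Data.List.Relation.Unary.Any using (here; there)
open import Data.List.Relation.Unary.All.Properties using (All¬⇒¬Any)
open import Data.List.Relation.Unary.AllPairs using ([]; _∷_)
open import Data.List.Membership.Propositional using () renaming (_∈_ to _∈ₗ_)
open import Data.List.Membership.Propositional.Properties using (∈-allFin)
open import Data.List.Relation.Unary.Unique.Propositional using (Unique)
open import Data.List.Relation.Unary.Unique.Propositional.Properties using (allFin⁺)
open import Data.Vec using ([]; _∷_; tabulate)
import Data.Vec as Vec
open import Data.Vec.Properties using ([]=⇒lookup; lookup⇒[]=; lookup∘tabulate)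
open import Function using (_∘_; Equivalence)
open import Function.Bundles using (Bijection)
open import Function.Definitions using (Injective; StrictlySurjective)
open import Relation.Binary.PropositionalEquality
  using (_≡_; _≢_; refl; sym; trans; cong; cong₂; subst; module ≡-Reasoning)
open import Relation.Nullary using (Dec; does; yes; no; contradiction)
open import Relation.Nullary.Decidable using (dec-true; _×-dec_)

private
  variable
    n : ℕ

∣p∪q∣≡∣p∣+∣q∣ : ∀ (p q : Subset n) → (∀ {x} → x ∈ p → x ∉ q) → ∣ p ∪ q ∣ ≡ ∣ p ∣ + ∣ q ∣
∣p∪q∣≡∣p∣+∣q∣ []      []       _   = refl
∣p∪q∣≡∣p∣+∣q∣ (_ ∷ p) (_ ∷ q) p#q with ∣p∪q∣≡∣p∣+∣q∣ p q (λ x∈p x∈q → p#q (Vec.there x∈p) (Vec.there x∈q))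
∣p∪q∣≡∣p∣+∣q∣ (inside  ∷ p) (inside  ∷ q) p#q | _  = contradiction Vec.here (p#q Vec.here)
∣p∪q∣≡∣p∣+∣q∣ (inside  ∷ p) (outside ∷ q) _   | ih = cong suc ih
∣p∪q∣≡∣p∣+∣q∣ (outside ∷ p) (inside  ∷ q) _   | ih = trans (cong suc ih) (sym (+-suc ∣ p ∣ ∣ q ∣))
∣p∪q∣≡∣p∣+∣q∣ (outside ∷ p) (outside ∷ q) _   | ih = ih

∣⁅x⁆∪⁅y⁆∣≡2 : ∀ {x y : Fin n} → x ≢ y → ∣ ⁅ x ⁆ ∪ ⁅ y ⁆ ∣ ≡ 2
∣⁅x⁆∪⁅y⁆∣≡2 {x = x} {y} x≢y = begin
  ∣ ⁅ x ⁆ ∪ ⁅ y ⁆ ∣       ≡⟨ ∣p∪q∣≡∣p∣+∣q∣ ⁅ x ⁆ ⁅ y ⁆ disjoint ⟩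
  ∣ ⁅ x ⁆ ∣ + ∣ ⁅ y ⁆ ∣   ≡⟨ cong₂ _+_ (∣⁅x⁆∣≡1 x) (∣⁅x⁆∣≡1 y) ⟩
  2                       ∎
  where
  open ≡-Reasoning
  disjoint : ∀ {z} → z ∈ ⁅ x ⁆ → z ∉ ⁅ y ⁆
  disjoint z∈x z∈y = x≢y (trans (sym (x∈⁅y⁆⇒x≡y x z∈x)) (x∈⁅y⁆⇒x≡y y z∈y))

∈-tabulate-does⁺ : ∀ {P : Fin n → Set} (P? : ∀ i → Dec (P i)) {x} → P x → x ∈ tabulate (does ∘ P?)
∈-tabulate-does⁺ P? {x} px = lookup⇒[]= x _ (trans (lookup∘tabulate (does ∘ P?) x) (dec-true (P? x) px))

∈-tabulate-does⁻ : ∀ {P : Fin n → Set} (P? : ∀ i → Dec (P i)) {x} → x ∈ tabulate (does ∘ P?) → P x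
∈-tabulate-does⁻ P? {x} x∈ = true⇒P (P? x) (trans (sym (lookup∘tabulate (does ∘ P?) x)) ([]=⇒lookup x∈))
  where
  true⇒P : ∀ {A : Set} (a? : Dec A) → does a? ≡ true → A
  true⇒P (yes a) _ = a

image : ∀ {A : Set} → (A → Fin n) → List A → Subset n
image g xs = ⋃ (map (λ a → ⁅ g a ⁆) xs)

module _ {A : Set} (g : A → Fin n) where

  ∈-image⁺ : ∀ {a xs} → a ∈ₗ xs → g a ∈ image g xs
  ∈-image⁺ {xs = x ∷ xs} (here refl) = x∈p∪q⁺ (inj₁ (x∈⁅x⁆ (g x)))
  ∈-image⁺ {xs = x ∷ xs} (there a∈xs) = x∈p∪q⁺ (inj₂ (∈-image⁺ a∈xs))

  ∈-image⁻ : ∀ {y} xs → y ∈ image g xs → ∃ λ a → a ∈ₗ xs × g a ≡ y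
  ∈-image⁻ []       y∈ = contradiction y∈ ∉⊥
  ∈-image⁻ (x ∷ xs) y∈ with x∈p∪q⁻ ⁅ g x ⁆ (image g xs) y∈
  ... | inj₁ y∈⁅gx⁆ = x , here refl , sym (x∈⁅y⁆⇒x≡y (g x) y∈⁅gx⁆)
  ... | inj₂ y∈img with a , a∈xs , ga≡y ← ∈-image⁻ xs y∈img = a , there a∈xs , ga≡y

  ∣image∣≡length : Injective _≡_ _≡_ g → ∀ {xs} → Unique xs → ∣ image g xs ∣ ≡ length xs
  ∣image∣≡length _     {[]}     _              = ∣⊥∣≡0 n
  ∣image∣≡length g-inj {x ∷ xs} (x∉xs ∷ xs!) = begin
    ∣ ⁅ g x ⁆ ∪ image g xs ∣        ≡⟨ ∣p∪q∣≡∣p∣+∣q∣ ⁅ g x ⁆ (image g xs) disjoint ⟩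
    ∣ ⁅ g x ⁆ ∣ + ∣ image g xs ∣    ≡⟨ cong₂ _+_ (∣⁅x⁆∣≡1 (g x)) (∣image∣≡length g-inj xs!) ⟩
    suc (length xs)                 ∎
    where
    open ≡-Reasoning
    disjoint : ∀ {y} → y ∈ ⁅ g x ⁆ → y ∉ image g xs
    disjoint y∈⁅gx⁆ y∈img with a , a∈xs , ga≡y ← ∈-image⁻ xs y∈img =
      All¬⇒¬Any x∉xs (subst (_∈ₗ xs) (g-inj (trans ga≡y (x∈⁅y⁆⇒x≡y (g x) y∈⁅gx⁆))) a∈xs)

module _ {m h : ℕ} (f : Fin m × Fin h → Fin n) where

  block : Fin m → Subset n
  block t = image (λ j → f (t , j)) (allFin h)

  ∈-block⁺ : ∀ t j → f (t , j) ∈ block t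
  ∈-block⁺ t j = ∈-image⁺ (λ j → f (t , j)) (∈-allFin j)

  ∈-block⁻ : ∀ {t x} → x ∈ block t → ∃ λ j → f (t , j) ≡ x
  ∈-block⁻ {t} x∈ with j , _ , e ← ∈-image⁻ (λ j → f (t , j)) (allFin h) x∈ = j , e

  ∣block∣≡h : Injective _≡_ _≡_ f → ∀ t → ∣ block t ∣ ≡ h
  ∣block∣≡h f-inj t =
    trans (∣image∣≡length (λ j → f (t , j)) (cong proj₂ ∘ f-inj) (allFin⁺ h)) (length-tabulate (λ j → j))

  block-disjoint : Injective _≡_ _≡_ f → ∀ {s t x} → x ∈ block s → x ∈ block t → s ≡ t
  block-disjoint f-inj x∈s x∈t with _ , e ← ∈-block⁻ x∈s | _ , e′ ← ∈-block⁻ x∈t =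
    cong proj₁ (f-inj (trans e (sym e′)))

  blocks-cover : StrictlySurjective _≡_ f → ∀ x → ∃ λ t → x ∈ block t
  blocks-cover f-surj x with (t , j) , e ← f-surj x = t , subst (_∈ block t) e (∈-block⁺ t j)

*-bounds⇒≤ : ∀ h {s t x} → h * s ≤ x → x < h * suc t → s ≤ t
*-bounds⇒≤ h lo hi = ≮⇒≥ λ t<s → <-irrefl refl (<-≤-trans hi (≤-trans (*-monoʳ-≤ h t<s) lo))

module _ (h m : ℕ) where

  ∈V⁻ : ∀ {t x} → x ∈ V h m t → h * toℕ t ≤ toℕ x × toℕ x < h * suc (toℕ t)
  ∈V⁻ {t} = ∈-tabulate-does⁻ (λ i → (h * toℕ t ≤? toℕ i) ×-dec (toℕ i <? h * suc (toℕ t)))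

  ∈V⁺ : ∀ {t x} → h * toℕ t ≤ toℕ x × toℕ x < h * suc (toℕ t) → x ∈ V h m t
  ∈V⁺ {t} = ∈-tabulate-does⁺ (λ i → (h * toℕ t ≤? toℕ i) ×-dec (toℕ i <? h * suc (toℕ t)))

  V-disjoint : ∀ {s t x} → x ∈ V h m s → x ∈ V h m t → s ≡ t
  V-disjoint x∈s x∈t with lo , hi ← ∈V⁻ x∈s | lo′ , hi′ ← ∈V⁻ x∈t =
    toℕ-injective (≤-antisym (*-bounds⇒≤ h lo hi′) (*-bounds⇒≤ h lo′ hi))

  rowMajor : Fin m × Fin h → Fin (h * m)
  rowMajor (t , j) = cast (*-comm m h) (combine t j)

  toℕ-rowMajor : ∀ t j → toℕ (rowMajor (t , j)) ≡ h * toℕ t + toℕ j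
  toℕ-rowMajor t j = trans (toℕ-cast (*-comm m h) (combine t j)) (toℕ-combine t j)

  rowMajor-injective : Injective _≡_ _≡_ rowMajor
  rowMajor-injective {t , j} {t′ , j′} e
    with refl , refl ← combine-injective t j t′ j′ (toℕ-injective
      (trans (sym (toℕ-cast (*-comm m h) (combine t j)))
             (trans (cong toℕ e) (toℕ-cast (*-comm m h) (combine t′ j′)))))
    = refl

  rowMajor-surjective : StrictlySurjective _≡_ rowMajor
  rowMajor-surjective x with t , j , e ← combine-surjective (cast (sym (*-comm m h)) x) =
    (t , j) , trans (cong (cast (*-comm m h)) e) (cast-involutive (*-comm m h) (sym (*-comm m h)) x)

  rowMajor∈V : ∀ t j → rowMajor (t , j) ∈ V h m t
  rowMajor∈V t j = ∈V⁺ (subst (λ x → h * toℕ t ≤ x × x < h * suc (toℕ t)) (sym (toℕ-rowMajor t j))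
    (m≤m+n (h * toℕ t) (toℕ j) ,
     subst (h * toℕ t + toℕ j <_) h*t+h≡h*[1+t] (+-monoʳ-< (h * toℕ t) (toℕ<n j))))
    where
    h*t+h≡h*[1+t] : h * toℕ t + h ≡ h * suc (toℕ t)
    h*t+h≡h*[1+t] = trans (+-comm (h * toℕ t) h) (sym (*-suc h (toℕ t)))

  V≡block : ∀ t → V h m t ≡ block rowMajor t
  V≡block t = ⊆-antisym V⊆block block⊆V
    where
    V⊆block : V h m t ⊆ block rowMajor t
    V⊆block {x} x∈V with (t′ , j) , e ← rowMajor-surjective x
      rewrite V-disjoint x∈V (subst (_∈ V h m t′) e (rowMajor∈V t′ j)) =
      subst (_∈ block rowMajor t′) e (∈-block⁺ rowMajor t′ j)
    block⊆V : block rowMajor t ⊆ V h m t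
    block⊆V x∈block with j , e ← ∈-block⁻ rowMajor x∈block = subst (_∈ V h m t) e (rowMajor∈V t j)

  ∣V∣≡h : ∀ t → ∣ V h m t ∣ ≡ h
  ∣V∣≡h t = trans (cong ∣_∣ (V≡block t)) (∣block∣≡h rowMajor rowMajor-injective t)

  V-cover : ∀ x → ∃ λ t → x ∈ V h m t
  V-cover x with t , x∈block ← blocks-cover rowMajor rowMajor-surjective x =
    t , subst (x ∈_) (sym (V≡block t)) x∈block

⊆-∪-cancelˡ : ∀ {p q r : Subset n} → p ⊆ q ∪ r → (∀ {x} → x ∈ p → x ∉ q) → p ⊆ r
⊆-∪-cancelˡ {q = q} {r} p⊆q∪r p#q x∈p with x∈p∪q⁻ q r (p⊆q∪r x∈p)
... | inj₁ x∈q = contradiction x∈q (p#q x∈p)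
... | inj₂ x∈r = x∈r

⊆-∪-cancelʳ : ∀ {p q r : Subset n} → p ⊆ q ∪ r → (∀ {x} → x ∈ p → x ∉ r) → p ⊆ q
⊆-∪-cancelʳ {q = q} {r} p⊆q∪r p#r x∈p with x∈p∪q⁻ q r (p⊆q∪r x∈p)
... | inj₁ x∈q = x∈q
... | inj₂ x∈r = contradiction x∈r (p#r x∈p)

-- Here W h m M t is definitionally block to t.
module _ {h m : ℕ} (M : PerfectMatchingK̂ h m) where
  open PerfectMatchingK̂ M
  open Bijection match using (to; injective; strictlySurjective)

  V#W : ∀ {t x} → x ∈ V h m t → x ∉ W h m M t
  V#W {t} x∈V x∈W with j , e ← ∈-block⁻ to x∈W = avoids t j (subst (_∈ V h m t) (sym e) x∈V)

  W-disjoint : ∀ {s t x} → x ∈ W h m M s → x ∈ W h m M t → s ≡ t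
  W-disjoint = block-disjoint to injective

  ∣edge∣≡2h : ∀ t → ∣ edge h m M t ∣ ≡ 2 * h
  ∣edge∣≡2h t = begin
    ∣ V h m t ∪ W h m M t ∣         ≡⟨ ∣p∪q∣≡∣p∣+∣q∣ (V h m t) (W h m M t) V#W ⟩
    ∣ V h m t ∣ + ∣ W h m M t ∣     ≡⟨ cong₂ _+_ (∣V∣≡h h m t) (∣block∣≡h to injective t) ⟩
    h + h                           ≡⟨ cong (h +_) (sym (+-identityʳ h)) ⟩
    2 * h                           ∎
    where open ≡-Reasoning

  ∈-edgesAt⁺ : ∀ {v t} → v ∈ edge h m M t → t ∈ edgesAt h m M v
  ∈-edgesAt⁺ {v} = ∈-tabulate-does⁺ (λ t → v ∈? edge h m M t)

  ∈-edgesAt⁻ : ∀ {v t} → t ∈ edgesAt h m M v → v ∈ edge h m M t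
  ∈-edgesAt⁻ {v} = ∈-tabulate-does⁻ (λ t → v ∈? edge h m M t)

  edgesAt≡⁅a⁆∪⁅b⁆ : ∀ v → ∃₂ λ a b → a ≢ b × edgesAt h m M v ≡ ⁅ a ⁆ ∪ ⁅ b ⁆
  edgesAt≡⁅a⁆∪⁅b⁆ v with a , v∈Va ← V-cover h m v | b , v∈Wb ← blocks-cover to strictlySurjective v =
    a , b , a≢b , ⊆-antisym edgesAt⊆ ⊆edgesAt
    where
    a≢b : a ≢ b
    a≢b refl = V#W v∈Va v∈Wb
    edgesAt⊆ : edgesAt h m M v ⊆ ⁅ a ⁆ ∪ ⁅ b ⁆
    edgesAt⊆ t∈ = x∈p∪q⁺ (Sum.map
      (λ v∈Vt → Equivalence.from x∈⁅y⁆⇔x≡y (V-disjoint h m v∈Vt v∈Va))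
      (λ v∈Wt → Equivalence.from x∈⁅y⁆⇔x≡y (W-disjoint v∈Wt v∈Wb))
      (x∈p∪q⁻ (V h m _) (W h m M _) (∈-edgesAt⁻ t∈)))
    ⊆edgesAt : ⁅ a ⁆ ∪ ⁅ b ⁆ ⊆ edgesAt h m M v
    ⊆edgesAt t∈ = ∈-edgesAt⁺ (x∈p∪q⁺ (Sum.map
      (λ t∈a → subst (λ s → v ∈ V h m s) (sym (x∈⁅y⁆⇒x≡y a t∈a)) v∈Va)
      (λ t∈b → subst (λ s → v ∈ W h m M s) (sym (x∈⁅y⁆⇒x≡y b t∈b)) v∈Wb)
      (x∈p∪q⁻ ⁅ a ⁆ ⁅ b ⁆ t∈)))

  ∣edgesAt∣≡2 : ∀ v → ∣ edgesAt h m M v ∣ ≡ 2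
  ∣edgesAt∣≡2 v with a , b , a≢b , e ← edgesAt≡⁅a⁆∪⁅b⁆ v = trans (cong ∣_∣ e) (∣⁅x⁆∪⁅y⁆∣≡2 a≢b)

  edge≡⇒W≡V : ∀ {s t} → s ≢ t → edge h m M s ≡ edge h m M t → W h m M t ≡ V h m s
  edge≡⇒W≡V {s} {t} s≢t e = ⊆-antisym W⊆V V⊆W
    where
    W⊆V : W h m M t ⊆ V h m s
    W⊆V = ⊆-∪-cancelʳ (λ x∈Wt → subst (_ ∈_) (sym e) (q⊆p∪q (V h m t) (W h m M t) x∈Wt))
                      (λ x∈Wt x∈Ws → s≢t (W-disjoint x∈Ws x∈Wt))
    V⊆W : V h m s ⊆ W h m M t
    V⊆W = ⊆-∪-cancelˡ (λ x∈Vs → subst (_ ∈_) e (p⊆p∪q (W h m M s) x∈Vs))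
                      (λ x∈Vs x∈Vt → s≢t (V-disjoint h m x∈Vs x∈Vt))

  edge-injective : (∀ s t → s ≢ t → W h m M t ≡ V h m s → W h m M s ≢ V h m t) →
                   ∀ s t → edge h m M s ≡ edge h m M t → s ≡ t
  edge-injective no-swap s t e with s ≟ t
  ... | yes s≡t = s≡t
  ... | no  s≢t = contradiction (edge≡⇒W≡V (s≢t ∘ sym) (sym e)) (no-swap s t s≢t (edge≡⇒W≡V s≢t e))

lemma4p4 : (k h m : ℕ) → k ≡ 2 * h → 2 < k → 1 ≤ m →
    (M : PerfectMatchingK̂ h m) →
    (∀ s t → s ≢ t → W h m M t ≡ V h m s → W h m M s ≢ V h m t) →
    -- k-uniform
    (∀ t → ∣ edge h m M t ∣ ≡ k)
    -- 2-regular
    × (∀ (v : Fin (h * m)) → ∣ edgesAt h m M v ∣ ≡ 2)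
    -- no multiple edges
    × (∀ s t → edge h m M s ≡ edge h m M t → s ≡ t)
lemma4p4 k h m refl _ _ M no-swap = ∣edge∣≡2h M , ∣edgesAt∣≡2 M , edge-injective M no-swap
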